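{- Let $\mathbf{M}$ be any $W$-model and $\varphi,\psi$ formulas. Then $\Box_L(\varphi\to\psi)$ is valid in $\mathbf{M}$ if and only if $[\![\varphi]\!]_{\mathbf{M}}\subseteq[\![\psi]\!]_{\mathbf{M}}$.
   Context: Language: a countable set $Pr$ of propositional variables, binary connectives $\land,\lor,\to$ and unary connectives $\neg,\Box,\Box_L$. A frame is $F=(S,\leq,R,*,Q,Q_L)$ where $(S,\leq)$ is a partially ordered set; $R\subseteq S^3$ satisfies: if $Rstu$, $s'\leq s$, $t'\leq t$, $u\leq u'$ then $Rs't'u'$; $*:S\to S$ satisfies $s\leq t\Rightarrow t^*\leq s^*$; $Q,Q_L\subseteq S^2$ satisfy: if $Qst$, $s'\leq s$, $t\leq t'$ then $Qs't'$ (same for $Q_L$). A valuation $V$ assigns to each $p$ an up-set. Interpretation: $[\![p]\!]=V(p)$; $\land$ intersection, $\lor$ union; $[\![\neg\varphi]\!]=\{s: s^*\notin[\![\varphi]\!]\}$; $[\![\varphi\to\psi]\!]=\{s:\forall t,u\,(Rstu \text{ and } t\in[\![\varphi]\!]\Rightarrow u\in[\![\psi]\!])\}$; $[\![\Box\varphi]\!]=\{s:\forall t\,(Qst\Rightarrow t\in[\![\varphi]\!])\}$; $[\![\Box_L\varphi]\!]$ likewise with $Q_L$. A frame is bounded if $(S,\le)$ has least element $0$ and greatest element $1$ and: $1^*=0$, $0^*=1$; $Q00$, $Q_L00$; $Q1s\Rightarrow s=1$, $Q_L1s\Rightarrow s=1$; $R010$; $R1st\Rightarrow(s=0$ or $t=1)$.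 In a bounded frame, $w\in S$ is a possible world if $w^*=w$, $Rwww$, and for all $s,t$: $Rwst\Rightarrow(s=0$ or $w\le t)$ and $Rwst\Rightarrow(t=1$ or $s\le w^*)$. A $W$-frame is $(F,W)$ with $F$ a bounded frame and $W\subseteq S$ a set of possible worlds such that (a) for all $w\in W$ and all $s,t,u$: if $Q_Lwu$ and $Rust$ then $s\le t$; (b) for every $s$ there are $w\in W$ and $u$ with $Q_Lwu$ and $Russ$. A $W$-model is a $W$-frame with a valuation $V$ such that each $V(p)$ is an up-set with $1\in V(p)$ and $0\notin V(p)$. A formula $\varphi$ is valid in a $W$-model iff $W\subseteq[\![\varphi]\!]$. -}

module Defs where

open import Data.Nat using (ℕ)
open import Data.Product using (_×_; Σ; ∃; ∃-syntax; _,_)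
open import Data.Sum using (_⊎_)
open import Data.Empty using (⊥)
open import Relation.Nullary using (¬_)
open import Relation.Binary.PropositionalEquality using (_≡_)
open import Relation.Binary.Structures using (IsPartialOrder)

Pr : Set
Pr = ℕ

data Formula : Set where
  var  : Pr → Formula
  _∧_  : Formula → Formula → Formula
  _∨_  : Formula → Formula → Formula
  _⇒_  : Formula → Formula → Formula
  ¬'_  : Formula → Formula
  □_   : Formula → Formula
  □L_  : Formula → Formula

record Frame : Set₁ where
  field
    S      : Set
    _≤_    : S → S → Set
    ≤-po   : IsPartialOrder _≡_ _≤_
    R      : S → S → S → Set
    R-mono : ∀ {s t u s' t' u'} → R s t u → s' ≤ s → t' ≤ t → u ≤ u' → R s' t' u'
    _*     : S → S
    *-anti : ∀ {s t} → s ≤ t → (t *) ≤ (s *)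
    Q      : S → S → Set
    Q-mono : ∀ {s t s' t'} → Q s t → s' ≤ s → t ≤ t' → Q s' t'
    QL     : S → S → Set
    QL-mono : ∀ {s t s' t'} → QL s t → s' ≤ s → t ≤ t' → QL s' t'

record BoundedFrame : Set₁ where
  field
    frame : Frame
  open Frame frame public
  field
    𝟘      : S
    𝟙      : S
    𝟘-least    : ∀ s → 𝟘 ≤ s
    𝟙-greatest : ∀ s → s ≤ 𝟙
    𝟙*     : (𝟙 *) ≡ 𝟘
    𝟘*     : (𝟘 *) ≡ 𝟙
    Q𝟘𝟘    : Q 𝟘 𝟘
    QL𝟘𝟘   : QL 𝟘 𝟘
    Q𝟙     : ∀ {s} → Q 𝟙 s → s ≡ 𝟙
    QL𝟙    : ∀ {s} → QL 𝟙 s → s ≡ 𝟙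
    R𝟘𝟙𝟘   : R 𝟘 𝟙 𝟘
    R𝟙     : ∀ {s t} → R 𝟙 s t → (s ≡ 𝟘) ⊎ (t ≡ 𝟙)

  IsPossibleWorld : S → Set
  IsPossibleWorld w =
    ((w *) ≡ w) × R w w w
    × (∀ s t → R w s t → (s ≡ 𝟘) ⊎ (w ≤ t))
    × (∀ s t → R w s t → (t ≡ 𝟙) ⊎ (s ≤ (w *)))

record WFrame : Set₁ where
  field
    bframe : BoundedFrame
  open BoundedFrame bframe public
  field
    W        : S → Set
    W-worlds : ∀ w → W w → IsPossibleWorld w
    W-a      : ∀ w s t u → W w → QL w u → R u s t → s ≤ t
    W-b      : ∀ s → ∃[ w ] ∃[ u ] (W w × QL w u × R u s s)

record WModel : Set₁ where
  field
    wframe : WFrame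
  open WFrame wframe public
  field
    V       : Pr → S → Set
    V-up    : ∀ p {s t} → s ≤ t → V p s → V p t
    V-𝟙     : ∀ p → V p 𝟙
    V-𝟘     : ∀ p → ¬ V p 𝟘

  ⟦_⟧ : Formula → S → Set
  ⟦ var p ⟧ s = V p s
  ⟦ φ ∧ ψ ⟧ s = ⟦ φ ⟧ s × ⟦ ψ ⟧ s
  ⟦ φ ∨ ψ ⟧ s = ⟦ φ ⟧ s ⊎ ⟦ ψ ⟧ s
  ⟦ φ ⇒ ψ ⟧ s = ∀ t u → R s t u → ⟦ φ ⟧ t → ⟦ ψ ⟧ u
  ⟦ ¬' φ ⟧ s = ¬ ⟦ φ ⟧ (s *)
  ⟦ □ φ ⟧ s = ∀ t → Q s t → ⟦ φ ⟧ t
  ⟦ □L φ ⟧ s = ∀ t → QL s t → ⟦ φ ⟧ t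

  Valid : Formula → Set
  Valid φ = ∀ w → W w → ⟦ φ ⟧ w

{-# OPTIONS --safe #-}
module Submission where

open import Defs
open import Function.Bundles using (_⇔_; mk⇔)
open import Data.Product using (_,_)
open import Data.Sum using (inj₁; inj₂)
open import Relation.Binary.Structures using (IsPartialOrder)

-- Condition (b) supplies, for every s, a world w and a Q_L-successor u of w
-- with R u s s, so validity of □L(φ ⇒ ψ) at w carries φ at s to ψ at s.
-- Conversely, by condition (a) every R-step out of a Q_L-successor of a
-- world goes up in the order, and truth sets are up-sets.

module _ (M : WModel) where
  open WModel M

  ≤-refl : ∀ {s} → s ≤ s
  ≤-refl = IsPartialOrder.refl ≤-po

  ⟦⟧-up : ∀ φ {s t} → s ≤ t → ⟦ φ ⟧ s → ⟦ φ ⟧ t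
  ⟦⟧-up (var p)  s≤t x       = V-up p s≤t x
  ⟦⟧-up (φ ∧ ψ)  s≤t (x , y) = ⟦⟧-up φ s≤t x , ⟦⟧-up ψ s≤t y
  ⟦⟧-up (φ ∨ ψ)  s≤t (inj₁ x) = inj₁ (⟦⟧-up φ s≤t x)
  ⟦⟧-up (φ ∨ ψ)  s≤t (inj₂ y) = inj₂ (⟦⟧-up ψ s≤t y)
  ⟦⟧-up (φ ⇒ ψ)  s≤t f t u r  = f t u (R-mono r s≤t ≤-refl ≤-refl)
  ⟦⟧-up (¬' φ)   s≤t n x      = n (⟦⟧-up φ (*-anti s≤t) x)
  ⟦⟧-up (□ φ)    s≤t f t q    = f t (Q-mono q s≤t ≤-refl)
  ⟦⟧-up (□L φ)   s≤t f t q    = f t (QL-mono q s≤t ≤-refl)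

  valid-□L⇒-⊆ : ∀ φ ψ → Valid (□L (φ ⇒ ψ)) → ∀ s → ⟦ φ ⟧ s → ⟦ ψ ⟧ s
  valid-□L⇒-⊆ φ ψ valid s φs with W-b s
  ... | w , u , w∈W , QLwu , Russ = valid w w∈W u QLwu s s Russ φs

  ⊆-valid-□L⇒ : ∀ φ ψ → (∀ s → ⟦ φ ⟧ s → ⟦ ψ ⟧ s) → Valid (□L (φ ⇒ ψ))
  ⊆-valid-□L⇒ φ ψ φ⊆ψ w w∈W u QLwu t v Rutv φt =
    ⟦⟧-up ψ (W-a w t v u w∈W QLwu Rutv) (φ⊆ψ t φt)

lemma4p6 : (M : WModel) (φ ψ : Formula) →
    WModel.Valid M (□L (φ ⇒ ψ)) ⇔ (∀ s → WModel.⟦_⟧ M φ s → WModel.⟦_⟧ M ψ s)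
lemma4p6 M φ ψ = mk⇔ (valid-□L⇒-⊆ M φ ψ) (⊆-valid-□L⇒ M φ ψ)
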